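{- If $\Delta;\Psi\vdash_e t:A$ and $t\to t'$, then $\Delta;\Psi\vdash_e t':A$.
   Context: Types: $A,B ::= \mathbb{1} \mid A\oplus B \mid A\otimes B \mid \mu X.A \mid X$ ($\mu$ binds $X$; only closed types are used; $A[X\leftarrow C]$ is substitution). Iso types: $\alpha ::= A\leftrightarrow B$. Syntax: values $v ::= () \mid x \mid \mathtt{inl}\,v \mid \mathtt{inr}\,v \mid \langle v_1,v_2\rangle \mid \mathtt{fold}\,v$; patterns $p ::= x \mid \langle p_1,p_2\rangle$; expressions $e ::= v \mid \mathtt{let}\,p_1=\omega\,p_2\,\mathtt{in}\,e$; isos $\omega ::= \{v_1\leftrightarrow e_1\mid\dots\mid v_n\leftrightarrow e_n\} \mid \mathtt{fix}\,f.\omega \mid f$ ($f$ an iso-variable); terms $t ::= () \mid x \mid \mathtt{inl}\,t\mid\mathtt{inr}\,t\mid\langle t_1,t_2\rangle\mid\mathtt{fold}\,t\mid \omega\,t\mid \mathtt{let}\,p=t_1\,\mathtt{in}\,t_2$. $(x_1,\dots,x_n)$ abbreviates $\langle x_1,\langle\dots,x_n\rangle\rangle$ and $A_1\otimes\dots\otimes A_n$ is right-nested. Terms are taken up to $\alpha$-conversion with all bound and free variable names distinct. Typing of terms $\Delta;\Psi\vdash_e t:A$, where $\Delta$ is a set of pairs $x:A$ (each variable at most once) and $\Psi$ is empty or a single pair $f:\alpha$: $\emptyset;\Psi\vdash_e():\mathbb{1}$; $x:A;\Psi\vdash_e x:A$; from $\Delta;\Psi\vdash_e t:A$ infer $\Delta;\Psi\vdash_e\mathtt{inl}\,t:A\oplus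 B$; from $\Delta;\Psi\vdash_e t:B$ infer $\Delta;\Psi\vdash_e\mathtt{inr}\,t:A\oplus B$; from $\Delta_1;\Psi\vdash_e t_1:A$ and $\Delta_2;\Psi\vdash_e t_2:B$ infer $\Delta_1,\Delta_2;\Psi\vdash_e\langle t_1,t_2\rangle:A\otimes B$; from $\Delta;\Psi\vdash_e t:A[X\leftarrow\mu X.A]$ infer $\Delta;\Psi\vdash_e\mathtt{fold}\,t:\mu X.A$; from $\Psi\vdash_\omega f:A\leftrightarrow B$ and $\Delta;\Psi\vdash_e t:A$ infer $\Delta;\Psi\vdash_e f\,t:B$; from $\vdash_\omega\omega:A\leftrightarrow B$ (empty iso-context) and $\Delta;\Psi\vdash_e t:A$ infer $\Delta;\Psi\vdash_e\omega\,t:B$; from $\Delta_1;\Psi\vdash_e t_1:A_1\otimes\dots\otimes A_n$ and $\Delta_2,x_1:A_1,\dots,x_n:A_n;\Psi\vdash_e t_2:B$ infer $\Delta_1,\Delta_2;\Psi\vdash_e\mathtt{let}\,(x_1,\dots,x_n)=t_1\,\mathtt{in}\,t_2:B$. Typing of isos $\Psi\vdash_\omega\omega:\alpha$: (i) if for each $i$, $\Delta_i\vdash_e v_i:A$ and $\Delta_i;\Psi\vdash_e e_i:B$, and $\mathtt{OD}_A(\{v_1,\dots,v_n\})$ and $\mathtt{OD}_B(\{Val(e_1),\dots,Val(e_n)\})$ hold, then $\Psi\vdash_\omega\{v_1\leftrightarrow e_1\mid\dots\mid v_n\leftrightarrow e_n\}:A\leftrightarrow B$, where $Val(\mathtt{let}\,p=\omega\,p'\,\mathtt{in}\,e)=Val(e)$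 and $Val(v)=v$; (ii) $f:\alpha\vdash_\omega f:\alpha$; (iii) if $f:\alpha\vdash_\omega\omega:\alpha$ and $\mathtt{fix}\,f.\omega$ is structurally recursive, then $\Psi\vdash_\omega\mathtt{fix}\,f.\omega:\alpha$. Structural recursion: $\mathtt{fix}\,f.\{v_1\leftrightarrow e_1\mid\dots\mid v_n\leftrightarrow e_n\}:A_1\otimes\dots\otimes A_m\leftrightarrow C$ is structurally recursive if there is $1\le j\le m$ with $A_j=\mu X.B$ such that for each $i$, $v_i=(v_i^1,\dots,v_i^m)$ and either $v_i^j$ is closed and $e_i$ contains no subterm $f\,p$, or $v_i^j$ is open and every subterm $f\,p$ of $e_i$ has $p=(x_1,\dots,x_m)$ with $x_j:\mu X.B$ a strict subterm of $v_i^j$. $\mathtt{OD}_A(S)$ is defined inductively: $\mathtt{OD}_A(\{x\})$; $\mathtt{OD}_{\mathbb{1}}(\{()\})$; if $\mathtt{OD}_A(S)$ and $\mathtt{OD}_B(T)$ then $\mathtt{OD}_{A\oplus B}(\{\mathtt{inl}\,v\mid v\in S\}\cup\{\mathtt{inr}\,v\mid v\in T\})$; if $\mathtt{OD}_{A[X\leftarrow\mu X.A]}(S)$ then $\mathtt{OD}_{\mu X.A}(\{\mathtt{fold}\,v\mid v\in S\})$; for a set $S$ of pairs, $\mathtt{OD}_{A\otimes B}(S)$ if either ($\mathtt{OD}_A(\pi_1 S)$ and $\forall v\in\pi_1 S$, $\mathtt{OD}_B(\{w\mid\langle v,w\rangle\in S\})$) or ($\mathtt{OD}_B(\pi_2 S)$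 and $\forall v\in\pi_2 S$, $\mathtt{OD}_A(\{w\mid\langle w,v\rangle\in S\})$), with $\pi_1 S=\{v\mid\langle v,w\rangle\in S\}$, $\pi_2 S=\{w\mid\langle v,w\rangle\in S\}$. Substitutions $\sigma$ map variables to values; $\sigma(t)$ replaces each $x$ with $(x\mapsto v)\in\sigma$ by $v$ (homomorphically, not capturing let-bound variables). Pattern matching $\sigma[v]=v'$: $\sigma[x]=e$ when $\sigma=\{x\mapsto e\}$; $\sigma[()]=()$; $\sigma[\mathtt{inl}\,e]=\mathtt{inl}\,e'$ if $\sigma[e]=e'$, similarly for $\mathtt{inr}$, $\mathtt{fold}$; $\sigma[\langle e_1,e_2\rangle]=\langle e_1',e_2'\rangle$ if $\sigma_1[e_1]=e_1'$, $\sigma_2[e_2]=e_2'$, $\sigma_1,\sigma_2$ have disjoint supports and $\sigma=\sigma_1\cup\sigma_2$. Evaluation contexts: $C ::= [\,] \mid \mathtt{inl}\,C\mid\mathtt{inr}\,C\mid\omega\,C\mid\mathtt{let}\,p=C\,\mathtt{in}\,t\mid\langle C,v\rangle\mid\langle v,C\rangle\mid\mathtt{fold}\,C\mid C\,t$. Reduction $\to$: if $t_1\to t_2$ then $C[t_1]\to C[t_2]$; $\mathtt{let}\,p=v\,\mathtt{in}\,t\to\sigma(t)$ if $\sigma[p]=v$; $\mathtt{fix}\,f.\omega\to\omega[f:=\mathtt{fix}\,f.\omega]$; $\{v_1\leftrightarrow e_1\mid\dots\mid v_n\leftrightarrow e_n\}\,v'\to\sigma(e_i)$ if $\sigma[v_i]=v'$.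 -}

module Defs where

open import Data.Nat using (ℕ; zero; suc; _≡ᵇ_)
open import Data.Fin using (Fin; zero; suc)
open import Data.Bool using (Bool; true; false; if_then_else_; _∨_)
open import Data.List using (List; []; _∷_; _++_; map)
open import Data.List.Membership.Propositional using (_∈_)
open import Data.List.Relation.Unary.All using (All)
open import Data.List.Relation.Unary.Unique.Propositional using (Unique)
open import Data.List.Relation.Binary.Disjoint.Propositional using (Disjoint)
open import Data.List.Relation.Binary.Permutation.Propositional using (_↭_)
open import Data.Vec as Vec using (Vec; lookup; toList)
open import Data.Maybe using (Maybe; just; nothing)
open import Data.Product using (Σ; ∃; ∃-syntax; _×_; _,_; proj₁; proj₂)
open import Data.Sum using (_⊎_)
open import Relation.Nullary using (¬_)
open import Relation.Binary.PropositionalEquality using (_≡_)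
open import Function.Bundles using (_⇔_)

-- Types (de Bruijn for the type variable X; `Ty n` has n free type
-- variables; only closed types `Type = Ty 0` are used for terms).

infixr 6 _⊗_
infixr 5 _⊕_

data Ty (n : ℕ) : Set where
  𝟙   : Ty n
  _⊕_ : Ty n → Ty n → Ty n
  _⊗_ : Ty n → Ty n → Ty n
  μ   : Ty (suc n) → Ty n          -- μ X . A  (X is de Bruijn index 0)
  `_  : Fin n → Ty n

Type : Set
Type = Ty 0

extR : ∀ {n m} → (Fin n → Fin m) → Fin (suc n) → Fin (suc m)
extR ρ zero    = zero
extR ρ (suc i) = suc (ρ i)

renT : ∀ {n m} → (Fin n → Fin m) → Ty n → Ty m
renT ρ 𝟙       = 𝟙
renT ρ (A ⊕ B) = renT ρ A ⊕ renT ρ B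
renT ρ (A ⊗ B) = renT ρ A ⊗ renT ρ B
renT ρ (μ A)   = μ (renT (extR ρ) A)
renT ρ (` i)   = ` ρ i

extS : ∀ {n m} → (Fin n → Ty m) → Fin (suc n) → Ty (suc m)
extS σ zero    = ` zero
extS σ (suc i) = renT suc (σ i)

subT : ∀ {n m} → (Fin n → Ty m) → Ty n → Ty m
subT σ 𝟙       = 𝟙
subT σ (A ⊕ B) = subT σ A ⊕ subT σ B
subT σ (A ⊗ B) = subT σ A ⊗ subT σ B
subT σ (μ A)   = μ (subT (extS σ) A)
subT σ (` i)   = σ i

single : ∀ {n} → Ty n → Fin (suc n) → Ty n
single C zero    = C
single C (suc i) = ` i

_⟦X≔_⟧ : ∀ {n} → Ty (suc n) → Ty n → Ty n
_⟦X≔_⟧ A C = subT (single C) A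

infix 4 _⟷_
data IsoTy : Set where
  _⟷_ : Type → Type → IsoTy

tupTy : ∀ {n} → Vec Type (suc n) → Type
tupTy (A Vec.∷ Vec.[])      = A
tupTy (A Vec.∷ (B Vec.∷ As)) = A ⊗ tupTy (B Vec.∷ As)

Var : Set
Var = ℕ

IVar : Set
IVar = ℕ

data Val : Set where
  unit : Val
  var  : Var → Val
  inl  : Val → Val
  inr  : Val → Val
  ⟨_,_⟩ : Val → Val → Val
  fold : Val → Val

data Pat : Set where
  pvar  : Var → Pat
  ⟨_,_⟩ₚ : Pat → Pat → Pat

mutual
  data Expr : Set where
    val  : Val → Expr
    elet : Pat → Iso → Pat → Expr → Expr

  data Iso : Set where
    clauses : List (Val × Expr) → Iso
    fix     : IVar → Iso → Iso
    ivar    : IVar → Iso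

data Term : Set where
  unitₜ : Term
  varₜ  : Var → Term
  inlₜ  : Term → Term
  inrₜ  : Term → Term
  pairₜ : Term → Term → Term
  foldₜ : Term → Term
  appₜ  : Iso → Term → Term
  letₜ  : Pat → Term → Term → Term

patVal : Pat → Val
patVal (pvar x)     = var x
patVal ⟨ p , q ⟩ₚ   = ⟨ patVal p , patVal q ⟩

⌜_⌝ᵥ : Val → Term
⌜ unit ⌝ᵥ        = unitₜ
⌜ var x ⌝ᵥ       = varₜ x
⌜ inl v ⌝ᵥ       = inlₜ ⌜ v ⌝ᵥ
⌜ inr v ⌝ᵥ       = inrₜ ⌜ v ⌝ᵥ
⌜ ⟨ v , w ⟩ ⌝ᵥ   = pairₜ ⌜ v ⌝ᵥ ⌜ w ⌝ᵥ
⌜ fold v ⌝ᵥ      = foldₜ ⌜ v ⌝ᵥ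

⌜_⌝ₑ : Expr → Term
⌜ val v ⌝ₑ          = ⌜ v ⌝ᵥ
⌜ elet p ω q e ⌝ₑ   = letₜ p (appₜ ω ⌜ patVal q ⌝ᵥ) ⌜ e ⌝ₑ

valOf : Expr → Val
valOf (val v)        = v
valOf (elet _ _ _ e) = valOf e

tupPat : ∀ {n} → Vec Var (suc n) → Pat
tupPat (x Vec.∷ Vec.[])       = pvar x
tupPat (x Vec.∷ (y Vec.∷ xs)) = ⟨ pvar x , tupPat (y Vec.∷ xs) ⟩ₚ

tupVal : ∀ {n} → Vec Val (suc n) → Val
tupVal (v Vec.∷ Vec.[])       = v
tupVal (v Vec.∷ (w Vec.∷ vs)) = ⟨ v , tupVal (w Vec.∷ vs) ⟩

patVars : Pat → List Var
patVars (pvar x)   = x ∷ []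
patVars ⟨ p , q ⟩ₚ = patVars p ++ patVars q

valVars : Val → List Var
valVars unit        = []
valVars (var x)     = x ∷ []
valVars (inl v)     = valVars v
valVars (inr v)     = valVars v
valVars ⟨ v , w ⟩   = valVars v ++ valVars w
valVars (fold v)    = valVars v

Closed : Val → Set
Closed v = valVars v ≡ []

memb : Var → List Var → Bool
memb x []       = false
memb x (y ∷ ys) = (x ≡ᵇ y) ∨ memb x ys

_∖_ : List Var → List Var → List Var
[] ∖ ys       = []
(x ∷ xs) ∖ ys = if memb x ys then xs ∖ ys else x ∷ (xs ∖ ys)

-- bound term variables (every binding occurrence, with multiplicity)
mutual
  bvI : Iso → List Var
  bvI (clauses cls) = bvCls cls
  bvI (fix f ω)     = bvI ω
  bvI (ivar f)      = []

  bvCls : List (Val × Expr) → List Var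
  bvCls []             = []
  bvCls ((v , e) ∷ cs) = valVars v ++ bvE e ++ bvCls cs

  bvE : Expr → List Var
  bvE (val v)        = []
  bvE (elet p ω q e) = patVars p ++ bvI ω ++ bvE e

bv : Term → List Var
bv unitₜ          = []
bv (varₜ x)       = []
bv (inlₜ t)       = bv t
bv (inrₜ t)       = bv t
bv (pairₜ t u)    = bv t ++ bv u
bv (foldₜ t)      = bv t
bv (appₜ ω t)     = bvI ω ++ bv t
bv (letₜ p t u)   = patVars p ++ bv t ++ bv u

mutual
  fvI : Iso → List Var
  fvI (clauses cls) = fvCls cls
  fvI (fix f ω)     = fvI ω
  fvI (ivar f)      = []

  fvCls : List (Val × Expr) → List Var
  fvCls []             = []
  fvCls ((v , e) ∷ cs) = (fvE e ∖ valVars v) ++ fvCls cs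

  fvE : Expr → List Var
  fvE (val v)        = valVars v
  fvE (elet p ω q e) = fvI ω ++ patVars q ++ (fvE e ∖ patVars p)

fv : Term → List Var
fv unitₜ          = []
fv (varₜ x)       = x ∷ []
fv (inlₜ t)       = fv t
fv (inrₜ t)       = fv t
fv (pairₜ t u)    = fv t ++ fv u
fv (foldₜ t)      = fv t
fv (appₜ ω t)     = fvI ω ++ fv t
fv (letₜ p t u)   = fv t ++ (fv u ∖ patVars p)

WellNamed : Term → Set
WellNamed t = Unique (bv t) × Disjoint (bv t) (fv t)

-- Orthogonal decomposition OD_A(S); sets of values are predicates.

π₁ : (Val → Set) → Val → Set
π₁ S v = ∃[ w ] S ⟨ v , w ⟩

π₂ : (Val → Set) → Val → Set
π₂ S w = ∃[ v ] S ⟨ v , w ⟩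

data OD : Type → (Val → Set) → Set₁ where
  od-var  : ∀ {A S} (x : Var) → (∀ v → S v ⇔ v ≡ var x) → OD A S
  od-unit : ∀ {S} → (∀ v → S v ⇔ v ≡ unit) → OD 𝟙 S
  od-sum  : ∀ {A B S T U} → OD A S → OD B T →
            (∀ v → U v ⇔ ((∃[ w ] (S w × v ≡ inl w)) ⊎ (∃[ w ] (T w × v ≡ inr w)))) →
            OD (A ⊕ B) U
  od-fold : ∀ {A S U} → OD (A ⟦X≔ μ A ⟧) S →
            (∀ v → U v ⇔ (∃[ w ] (S w × v ≡ fold w))) → OD (μ A) U
  od-pair₁ : ∀ {A B S} → (∀ v → S v → ∃[ a ] ∃[ b ] (v ≡ ⟨ a , b ⟩)) →
             OD A (π₁ S) → (∀ a → π₁ S a → OD B (λ b → S ⟨ a , b ⟩)) →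
             OD (A ⊗ B) S
  od-pair₂ : ∀ {A B S} → (∀ v → S v → ∃[ a ] ∃[ b ] (v ≡ ⟨ a , b ⟩)) →
             OD B (π₂ S) → (∀ b → π₂ S b → OD A (λ a → S ⟨ a , b ⟩)) →
             OD (A ⊗ B) S

data _⊏_ : Val → Val → Set where
  ⊏-inl   : ∀ {v} → v ⊏ inl v
  ⊏-inr   : ∀ {v} → v ⊏ inr v
  ⊏-fold  : ∀ {v} → v ⊏ fold v
  ⊏-fst   : ∀ {v w} → v ⊏ ⟨ v , w ⟩
  ⊏-snd   : ∀ {v w} → w ⊏ ⟨ v , w ⟩
  ⊏-trans : ∀ {u v w} → u ⊏ v → v ⊏ w → u ⊏ w

data Calls (f : IVar) (p : Pat) : Expr → Set where
  here  : ∀ {p₁ e} → Calls f p (elet p₁ (ivar f) p e)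
  there : ∀ {p₁ ω p₂ e} → Calls f p e → Calls f p (elet p₁ ω p₂ e)

Ctx : Set
Ctx = List (Var × Type)

names : Ctx → List Var
names = map proj₁

IsoCtx : Set
IsoCtx = Maybe (IVar × IsoTy)

infix 3 _⨾_⊢ₑ_∶_ _⊢ω_∶_

mutual
  data _⨾_⊢ₑ_∶_ : Ctx → IsoCtx → Term → Type → Set₁ where
    ty-unit : ∀ {Ψ} → [] ⨾ Ψ ⊢ₑ unitₜ ∶ 𝟙
    ty-var  : ∀ {Ψ x A} → ((x , A) ∷ []) ⨾ Ψ ⊢ₑ varₜ x ∶ A
    ty-inl  : ∀ {Δ Ψ t A B} → Δ ⨾ Ψ ⊢ₑ t ∶ A → Δ ⨾ Ψ ⊢ₑ inlₜ t ∶ A ⊕ B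
    ty-inr  : ∀ {Δ Ψ t A B} → Δ ⨾ Ψ ⊢ₑ t ∶ B → Δ ⨾ Ψ ⊢ₑ inrₜ t ∶ A ⊕ B
    -- Δ is the (set) union Δ₁,Δ₂, each variable at most once
    ty-pair : ∀ {Δ Δ₁ Δ₂ Ψ t₁ t₂ A B} →
              Δ₁ ⨾ Ψ ⊢ₑ t₁ ∶ A → Δ₂ ⨾ Ψ ⊢ₑ t₂ ∶ B →
              Unique (names (Δ₁ ++ Δ₂)) → Δ ↭ Δ₁ ++ Δ₂ →
              Δ ⨾ Ψ ⊢ₑ pairₜ t₁ t₂ ∶ A ⊗ B
    ty-fold : ∀ {Δ Ψ t A} → Δ ⨾ Ψ ⊢ₑ t ∶ A ⟦X≔ μ A ⟧ → Δ ⨾ Ψ ⊢ₑ foldₜ t ∶ μ A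
    ty-appvar : ∀ {Δ Ψ f t A B} → Ψ ⊢ω ivar f ∶ (A ⟷ B) → Δ ⨾ Ψ ⊢ₑ t ∶ A →
                Δ ⨾ Ψ ⊢ₑ appₜ (ivar f) t ∶ B
    ty-app  : ∀ {Δ Ψ ω t A B} → nothing ⊢ω ω ∶ (A ⟷ B) → Δ ⨾ Ψ ⊢ₑ t ∶ A →
              Δ ⨾ Ψ ⊢ₑ appₜ ω t ∶ B
    -- let (x₁,…,xₙ) = t₁ in t₂, with bs = (x₁:A₁,…,xₙ:Aₙ)
    ty-let  : ∀ {n Δ Δ₁ Δ₂ Ψ t₁ t₂ B} (bs : Vec (Var × Type) (suc n)) →
              Δ₁ ⨾ Ψ ⊢ₑ t₁ ∶ tupTy (Vec.map proj₂ bs) →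
              (Δ₂ ++ toList bs) ⨾ Ψ ⊢ₑ t₂ ∶ B →
              Unique (names (Δ₁ ++ Δ₂)) → Unique (names (Δ₂ ++ toList bs)) →
              Δ ↭ Δ₁ ++ Δ₂ →
              Δ ⨾ Ψ ⊢ₑ letₜ (tupPat (Vec.map proj₁ bs)) t₁ t₂ ∶ B

  data _⊢ω_∶_ : IsoCtx → Iso → IsoTy → Set₁ where
    ty-clauses : ∀ {Ψ A B} (cls : List (Val × Expr)) →
                 All (λ c → ∃[ Δ ] ((Δ ⨾ nothing ⊢ₑ ⌜ proj₁ c ⌝ᵥ ∶ A)
                                    × (Δ ⨾ Ψ ⊢ₑ ⌜ proj₂ c ⌝ₑ ∶ B))) cls →
                 OD A (λ v → v ∈ map proj₁ cls) →
                 OD B (λ w → w ∈ map (λ c → valOf (proj₂ c)) cls) →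
                 Ψ ⊢ω clauses cls ∶ (A ⟷ B)
    ty-ivar : ∀ {f α} → just (f , α) ⊢ω ivar f ∶ α
    ty-fix  : ∀ {Ψ f ω α} → just (f , α) ⊢ω ω ∶ α → StructRec f ω α →
              Ψ ⊢ω fix f ω ∶ α

  -- fix f.{v₁ ↔ e₁ | … } : A₁ ⊗ … ⊗ Aₘ ↔ C is structurally recursive
  -- (m = suc k, index j, Aⱼ = μX.B)
  data StructRec (f : IVar) : Iso → IsoTy → Set₁ where
    sr : ∀ {k C} (cls : List (Val × Expr)) (As : Vec Type (suc k))
           (j : Fin (suc k)) (B : Ty 1) → lookup As j ≡ μ B →
         All (λ c → SRClause f As j B (proj₁ c) (proj₂ c)) cls →
         StructRec f (clauses cls) (tupTy As ⟷ C)

  data SRClause (f : IVar) {k : ℕ} (As : Vec Type (suc k)) (j : Fin (suc k))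
                (B : Ty 1) (v : Val) (e : Expr) : Set₁ where
    src-closed : (vs : Vec Val (suc k)) → tupVal vs ≡ v →
                 Closed (lookup vs j) → (∀ p → ¬ Calls f p e) →
                 SRClause f As j B v e
    src-open   : (vs : Vec Val (suc k)) → tupVal vs ≡ v →
                 ¬ Closed (lookup vs j) →
                 (∀ p → Calls f p e →
                    ∃[ xs ] (p ≡ tupPat xs
                      × (∃[ Δ ] ((Δ ⨾ nothing ⊢ₑ ⌜ v ⌝ᵥ ∶ tupTy As)
                                 × (lookup xs j , μ B) ∈ Δ))
                      × var (lookup xs j) ⊏ lookup vs j)) →
                 SRClause f As j B v e

Subst : Set
Subst = List (Var × Val)

dom : Subst → List Var
dom = map proj₁

lookupσ : Subst → Var → Maybe Val
lookupσ [] x             = nothing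
lookupσ ((y , v) ∷ σ) x  = if x ≡ᵇ y then just v else lookupσ σ x

removeσ : Subst → List Var → Subst
removeσ [] xs            = []
removeσ ((y , v) ∷ σ) xs = if memb y xs then removeσ σ xs else (y , v) ∷ removeσ σ xs

-- σ(t): homomorphic, not substituting let-bound variables
-- (isos are closed w.r.t. term variables, so σ does not enter them)
applyS : Subst → Term → Term
applyS σ unitₜ        = unitₜ
applyS σ (varₜ x) with lookupσ σ x
... | just v  = ⌜ v ⌝ᵥ
... | nothing = varₜ x
applyS σ (inlₜ t)     = inlₜ (applyS σ t)
applyS σ (inrₜ t)     = inrₜ (applyS σ t)
applyS σ (pairₜ t u)  = pairₜ (applyS σ t) (applyS σ u)
applyS σ (foldₜ t)    = foldₜ (applyS σ t)
applyS σ (appₜ ω t)   = appₜ ω (applyS σ t)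
applyS σ (letₜ p t u) = letₜ p (applyS σ t) (applyS (removeσ σ (patVars p)) u)

data Match : Subst → Val → Val → Set where
  m-var  : ∀ {x w} → Match ((x , w) ∷ []) (var x) w
  m-unit : Match [] unit unit
  m-inl  : ∀ {σ v w} → Match σ v w → Match σ (inl v) (inl w)
  m-inr  : ∀ {σ v w} → Match σ v w → Match σ (inr v) (inr w)
  m-fold : ∀ {σ v w} → Match σ v w → Match σ (fold v) (fold w)
  m-pair : ∀ {σ₁ σ₂ v₁ v₂ w₁ w₂} → Match σ₁ v₁ w₁ → Match σ₂ v₂ w₂ →
           Disjoint (dom σ₁) (dom σ₂) →
           Match (σ₁ ++ σ₂) ⟨ v₁ , v₂ ⟩ ⟨ w₁ , w₂ ⟩

mutual
  isubI : IVar → Iso → Iso → Iso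
  isubI f ω₀ (clauses cls) = clauses (isubCls f ω₀ cls)
  isubI f ω₀ (fix g ω)     = if f ≡ᵇ g then fix g ω else fix g (isubI f ω₀ ω)
  isubI f ω₀ (ivar g)      = if f ≡ᵇ g then ω₀ else ivar g

  isubCls : IVar → Iso → List (Val × Expr) → List (Val × Expr)
  isubCls f ω₀ []             = []
  isubCls f ω₀ ((v , e) ∷ cs) = (v , isubE f ω₀ e) ∷ isubCls f ω₀ cs

  isubE : IVar → Iso → Expr → Expr
  isubE f ω₀ (val v)        = val v
  isubE f ω₀ (elet p ω q e) = elet p (isubI f ω₀ ω) q (isubE f ω₀ e)

infix 3 _⟶ᵢ_ _⟶_

data _⟶ᵢ_ : Iso → Iso → Set where
  r-fix : ∀ {f ω} → fix f ω ⟶ᵢ isubI f (fix f ω) ω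

data _⟶_ : Term → Term → Set where
  c-inl   : ∀ {t t'} → t ⟶ t' → inlₜ t ⟶ inlₜ t'
  c-inr   : ∀ {t t'} → t ⟶ t' → inrₜ t ⟶ inrₜ t'
  c-fold  : ∀ {t t'} → t ⟶ t' → foldₜ t ⟶ foldₜ t'
  c-app   : ∀ {ω t t'} → t ⟶ t' → appₜ ω t ⟶ appₜ ω t'
  c-let   : ∀ {p t₁ t₁' t₂} → t₁ ⟶ t₁' → letₜ p t₁ t₂ ⟶ letₜ p t₁' t₂
  c-pairₗ : ∀ {t t' v} → t ⟶ t' → pairₜ t ⌜ v ⌝ᵥ ⟶ pairₜ t' ⌜ v ⌝ᵥ
  c-pairᵣ : ∀ {t t' v} → t ⟶ t' → pairₜ ⌜ v ⌝ᵥ t ⟶ pairₜ ⌜ v ⌝ᵥ t'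
  c-iso   : ∀ {ω ω' t} → ω ⟶ᵢ ω' → appₜ ω t ⟶ appₜ ω' t
  r-let   : ∀ {σ p v t} → Match σ (patVal p) v → letₜ p ⌜ v ⌝ᵥ t ⟶ applyS σ t
  r-iso   : ∀ {σ cls v e v'} → (v , e) ∈ cls → Match σ v v' →
            appₜ (clauses cls) ⌜ v' ⌝ᵥ ⟶ applyS σ ⌜ e ⌝ₑ

-- Unfolding fix f.ω substitutes
-- the recursive iso for f, which preserves typing since f was typed at the iso type of
-- fix f.ω, and preserves structural recursion since substitution creates no new calls
-- to f. Both β-steps rest on a substitution lemma: matching a value v against a pattern
-- value u of the same type yields a substitution sending the context of u to that of v,
-- and applying it to a term typed with u's variables gives a term typed with v's. The
-- naming convention guarantees that binders in the term never capture those variables.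
module Submission where

open import Defs
open import Data.Bool using (true; false)
open import Data.Empty using (⊥-elim)
open import Data.List using (List; []; _∷_; _++_; map)
open import Data.List.Properties using (map-++; ++-identityʳ; ++-assoc)
open import Data.List.Membership.Propositional using (_∈_; _∉_)
open import Data.List.Membership.Propositional.Properties using (∈-++⁺ˡ; ∈-++⁺ʳ; ∈-++⁻)
open import Data.List.Relation.Unary.Any using (here; there; tail)
open import Data.List.Relation.Unary.All as All using (All; []; _∷_)
import Data.List.Relation.Unary.All.Properties as All
open import Data.List.Relation.Unary.AllPairs using ([]; _∷_)
open import Data.List.Relation.Unary.Unique.Propositional using (Unique)
import Data.List.Relation.Unary.Unique.Propositional.Properties as Unique
open import Data.List.Relation.Binary.Disjoint.Propositional using (Disjoint)
open import Data.List.Relation.Binary.Permutation.Propositional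
  using (_↭_; ↭-refl; ↭-sym; ↭-trans; ↭⇒↭ₛ)
import Data.List.Relation.Binary.Permutation.Propositional as ↭
import Data.List.Relation.Binary.Permutation.Propositional.Properties as ↭
import Data.List.Relation.Binary.Permutation.Setoid.Properties as ↭ₛ
open import Data.Maybe using (just; nothing)
open import Data.Nat using (suc; _≡ᵇ_)
open import Data.Nat.Properties using (≡ᵇ⇒≡; ≡⇒≡ᵇ)
open import Data.Product using (∃-syntax; _×_; _,_; proj₁; proj₂)
open import Data.Sum using (_⊎_; inj₁; inj₂)
open import Data.Vec as Vec using (Vec; toList)
open import Data.Vec.Properties using (toList-map)
open import Function using (_∘_)
open import Relation.Binary.Definitions using (_Respects_)
open import Relation.Binary.PropositionalEquality
open import Relation.Nullary.Reflects using (Reflects; ofʸ; ofⁿ; fromEquivalence)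

private
  variable
    x : Var
    xs ys : List Var
    Δ Δ' Δ₁ Δ₂ Γ D : Ctx
    Ψ : IsoCtx
    t : Term
    A B : Type

≡ᵇ-reflects : ∀ m n → Reflects (m ≡ n) (m ≡ᵇ n)
≡ᵇ-reflects m n = fromEquivalence (≡ᵇ⇒≡ m n) (≡⇒≡ᵇ m n)

memb-reflects : ∀ x ys → Reflects (x ∈ ys) (memb x ys)
memb-reflects x [] = ofⁿ λ ()
memb-reflects x (y ∷ ys) with x ≡ᵇ y | ≡ᵇ-reflects x y
... | true  | ofʸ x≡y = ofʸ (here x≡y)
... | false | ofⁿ x≢y with memb x ys | memb-reflects x ys
...   | true  | ofʸ x∈ys = ofʸ (there x∈ys)
...   | false | ofⁿ x∉ys = ofⁿ λ { (here x≡y) → x≢y x≡y ; (there x∈ys) → x∉ys x∈ys }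

∈-∖⁺ : ∀ xs → x ∈ xs → x ∉ ys → x ∈ xs ∖ ys
∈-∖⁺ {ys = ys} (y ∷ xs) x∈ x∉ys with memb y ys | memb-reflects y ys
∈-∖⁺ (y ∷ xs) (here refl) x∉ys | true  | ofʸ y∈ys = ⊥-elim (x∉ys y∈ys)
∈-∖⁺ (y ∷ xs) (there x∈)  x∉ys | true  | _        = ∈-∖⁺ xs x∈ x∉ys
∈-∖⁺ (y ∷ xs) (here refl) x∉ys | false | _        = here refl
∈-∖⁺ (y ∷ xs) (there x∈)  x∉ys | false | _        = there (∈-∖⁺ xs x∈ x∉ys)

module _ {A : Set} where

  Unique-resp-↭ : Unique {A = A} Respects _↭_
  Unique-resp-↭ p = ↭ₛ.Unique-resp-↭ (setoid A) (↭⇒↭ₛ p)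

  Unique-++⁻ˡ : ∀ (xs : List A) {ys} → Unique (xs ++ ys) → Unique xs
  Unique-++⁻ˡ []       _        = []
  Unique-++⁻ˡ (x ∷ xs) (x∉ ∷ u) = All.++⁻ˡ xs x∉ ∷ Unique-++⁻ˡ xs u

  Unique-++⁻ʳ : ∀ (xs : List A) {ys} → Unique (xs ++ ys) → Unique ys
  Unique-++⁻ʳ []       u       = u
  Unique-++⁻ʳ (x ∷ xs) (_ ∷ u) = Unique-++⁻ʳ xs u

  Unique-++⇒Disjoint : ∀ (xs : List A) {ys} → Unique (xs ++ ys) → Disjoint xs ys
  Unique-++⇒Disjoint (x ∷ xs) (x∉ ∷ _) (here refl , z∈ys) = All.lookup (All.++⁻ʳ xs x∉) z∈ys refl
  Unique-++⇒Disjoint (x ∷ xs) (_ ∷ u)  (there z∈xs , z∈ys) = Unique-++⇒Disjoint xs u (z∈xs , z∈ys)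

names-++ : ∀ Δ₁ Δ₂ → names (Δ₁ ++ Δ₂) ≡ names Δ₁ ++ names Δ₂
names-++ = map-++ proj₁

∈-names-resp-↭ : Δ ↭ Δ' → x ∈ names Δ → x ∈ names Δ'
∈-names-resp-↭ p = ↭.∈-resp-↭ (↭.map⁺ proj₁ p)

Unique-names-resp-↭ : Δ ↭ Δ' → Unique (names Δ) → Unique (names Δ')
Unique-names-resp-↭ p = Unique-resp-↭ (↭.map⁺ proj₁ p)

∈-names-++⁺ˡ : ∀ Δ₁ Δ₂ → x ∈ names Δ₁ → x ∈ names (Δ₁ ++ Δ₂)
∈-names-++⁺ˡ Δ₁ Δ₂ x∈ = subst (_ ∈_) (sym (names-++ Δ₁ Δ₂)) (∈-++⁺ˡ x∈)

∈-names-++⁺ʳ : ∀ Δ₁ Δ₂ → x ∈ names Δ₂ → x ∈ names (Δ₁ ++ Δ₂)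
∈-names-++⁺ʳ Δ₁ Δ₂ x∈ = subst (_ ∈_) (sym (names-++ Δ₁ Δ₂)) (∈-++⁺ʳ (names Δ₁) x∈)

∈-names-++⁻ : ∀ Δ₁ Δ₂ → x ∈ names (Δ₁ ++ Δ₂) → x ∈ names Δ₁ ⊎ x ∈ names Δ₂
∈-names-++⁻ Δ₁ Δ₂ x∈ = ∈-++⁻ (names Δ₁) (subst (_ ∈_) (names-++ Δ₁ Δ₂) x∈)

Unique-names-++⁻ˡ : ∀ Δ₁ Δ₂ → Unique (names (Δ₁ ++ Δ₂)) → Unique (names Δ₁)
Unique-names-++⁻ˡ Δ₁ Δ₂ u = Unique-++⁻ˡ (names Δ₁) (subst Unique (names-++ Δ₁ Δ₂) u)

Unique-names-++⁻ʳ : ∀ Δ₁ Δ₂ → Unique (names (Δ₁ ++ Δ₂)) → Unique (names Δ₂)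
Unique-names-++⁻ʳ Δ₁ Δ₂ u = Unique-++⁻ʳ (names Δ₁) (subst Unique (names-++ Δ₁ Δ₂) u)

Unique-names-++⇒Disjoint : ∀ Δ₁ Δ₂ → Unique (names (Δ₁ ++ Δ₂)) → Disjoint (names Δ₁) (names Δ₂)
Unique-names-++⇒Disjoint Δ₁ Δ₂ u = Unique-++⇒Disjoint (names Δ₁) (subst Unique (names-++ Δ₁ Δ₂) u)

Unique-names-++⁺ : ∀ Δ₁ Δ₂ → Unique (names Δ₁) → Unique (names Δ₂) →
                   Disjoint (names Δ₁) (names Δ₂) → Unique (names (Δ₁ ++ Δ₂))
Unique-names-++⁺ Δ₁ Δ₂ u₁ u₂ d = subst Unique (sym (names-++ Δ₁ Δ₂)) (Unique.++⁺ u₁ u₂ d)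

⊢-resp-↭ : Δ ↭ Δ' → Δ ⨾ Ψ ⊢ₑ t ∶ A → Δ' ⨾ Ψ ⊢ₑ t ∶ A
⊢-resp-↭ p ty-unit with refl ← ↭.↭-empty-inv (↭-sym p)     = ty-unit
⊢-resp-↭ p ty-var  with refl ← ↭.↭-singleton-inv (↭-sym p) = ty-var
⊢-resp-↭ p (ty-inl d)                = ty-inl (⊢-resp-↭ p d)
⊢-resp-↭ p (ty-inr d)                = ty-inr (⊢-resp-↭ p d)
⊢-resp-↭ p (ty-pair d₁ d₂ u q)       = ty-pair d₁ d₂ u (↭-trans (↭-sym p) q)
⊢-resp-↭ p (ty-fold d)               = ty-fold (⊢-resp-↭ p d)
⊢-resp-↭ p (ty-appvar i d)           = ty-appvar i (⊢-resp-↭ p d)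
⊢-resp-↭ p (ty-app i d)              = ty-app i (⊢-resp-↭ p d)
⊢-resp-↭ p (ty-let bs d₁ d₂ u₁ u₂ q) = ty-let bs d₁ d₂ u₁ u₂ (↭-trans (↭-sym p) q)

⊢⇒Unique-names : Δ ⨾ Ψ ⊢ₑ t ∶ A → Unique (names Δ)
⊢⇒Unique-names ty-unit              = []
⊢⇒Unique-names ty-var               = [] ∷ []
⊢⇒Unique-names (ty-inl d)           = ⊢⇒Unique-names d
⊢⇒Unique-names (ty-inr d)           = ⊢⇒Unique-names d
⊢⇒Unique-names (ty-pair _ _ u q)    = Unique-names-resp-↭ (↭-sym q) u
⊢⇒Unique-names (ty-fold d)          = ⊢⇒Unique-names d
⊢⇒Unique-names (ty-appvar _ d)      = ⊢⇒Unique-names d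
⊢⇒Unique-names (ty-app _ d)         = ⊢⇒Unique-names d
⊢⇒Unique-names (ty-let _ _ _ u _ q) = Unique-names-resp-↭ (↭-sym q) u

⊢-weaken-isoCtx : Δ ⨾ nothing ⊢ₑ t ∶ A → Δ ⨾ Ψ ⊢ₑ t ∶ A
⊢-weaken-isoCtx ty-unit             = ty-unit
⊢-weaken-isoCtx ty-var              = ty-var
⊢-weaken-isoCtx (ty-inl d)          = ty-inl (⊢-weaken-isoCtx d)
⊢-weaken-isoCtx (ty-inr d)          = ty-inr (⊢-weaken-isoCtx d)
⊢-weaken-isoCtx (ty-pair d₁ d₂ u q) = ty-pair (⊢-weaken-isoCtx d₁) (⊢-weaken-isoCtx d₂) u q
⊢-weaken-isoCtx (ty-fold d)         = ty-fold (⊢-weaken-isoCtx d)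
⊢-weaken-isoCtx (ty-appvar () _)
⊢-weaken-isoCtx (ty-app i d)        = ty-app i (⊢-weaken-isoCtx d)
⊢-weaken-isoCtx (ty-let bs d₁ d₂ u₁ u₂ q) =
  ty-let bs (⊢-weaken-isoCtx d₁) (⊢-weaken-isoCtx d₂) u₁ u₂ q

patVars-tupPat : ∀ {n} (bs : Vec (Var × Type) (suc n)) →
                 patVars (tupPat (Vec.map proj₁ bs)) ≡ names (toList bs)
patVars-tupPat bs = trans (go (Vec.map proj₁ bs)) (toList-map proj₁ bs)
  where
  go : ∀ {n} (xs : Vec Var (suc n)) → patVars (tupPat xs) ≡ toList xs
  go (x Vec.∷ Vec.[])       = refl
  go (x Vec.∷ (y Vec.∷ xs)) = cong (x ∷_) (go (y Vec.∷ xs))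

⊢-names⊆fv : Δ ⨾ Ψ ⊢ₑ t ∶ A → x ∈ names Δ → x ∈ fv t
⊢-names⊆fv ty-var x∈ = x∈
⊢-names⊆fv (ty-inl d) x∈ = ⊢-names⊆fv d x∈
⊢-names⊆fv (ty-inr d) x∈ = ⊢-names⊆fv d x∈
⊢-names⊆fv (ty-fold d) x∈ = ⊢-names⊆fv d x∈
⊢-names⊆fv (ty-appvar {f = f} _ d) x∈ = ∈-++⁺ʳ (fvI (ivar f)) (⊢-names⊆fv d x∈)
⊢-names⊆fv (ty-app {ω = ω} _ d) x∈ = ∈-++⁺ʳ (fvI ω) (⊢-names⊆fv d x∈)
⊢-names⊆fv (ty-pair {Δ₁ = Δ₁} {Δ₂} {t₁ = t₁} d₁ d₂ _ q) x∈
  with ∈-names-++⁻ Δ₁ Δ₂ (∈-names-resp-↭ q x∈)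
... | inj₁ x∈₁ = ∈-++⁺ˡ (⊢-names⊆fv d₁ x∈₁)
... | inj₂ x∈₂ = ∈-++⁺ʳ (fv t₁) (⊢-names⊆fv d₂ x∈₂)
⊢-names⊆fv (ty-let {Δ₁ = Δ₁} {Δ₂} {t₁ = t₁} {t₂} bs d₁ d₂ _ u₂ q) x∈
  with ∈-names-++⁻ Δ₁ Δ₂ (∈-names-resp-↭ q x∈)
... | inj₁ x∈₁ = ∈-++⁺ˡ (⊢-names⊆fv d₁ x∈₁)
... | inj₂ x∈₂ = ∈-++⁺ʳ (fv t₁) (∈-∖⁺ (fv t₂) (⊢-names⊆fv d₂ (∈-names-++⁺ˡ Δ₂ (toList bs) x∈₂)) x∉bs)
  where
  x∉bs : _ ∉ patVars (tupPat (Vec.map proj₁ bs))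
  x∉bs x∈bs = Unique-names-++⇒Disjoint Δ₂ (toList bs) u₂ (x∈₂ , subst (_ ∈_) (patVars-tupPat bs) x∈bs)

bv-⌜⌝ᵥ : ∀ v → bv ⌜ v ⌝ᵥ ≡ []
bv-⌜⌝ᵥ unit      = refl
bv-⌜⌝ᵥ (var x)   = refl
bv-⌜⌝ᵥ (inl v)   = bv-⌜⌝ᵥ v
bv-⌜⌝ᵥ (inr v)   = bv-⌜⌝ᵥ v
bv-⌜⌝ᵥ ⟨ v , w ⟩ = cong₂ _++_ (bv-⌜⌝ᵥ v) (bv-⌜⌝ᵥ w)
bv-⌜⌝ᵥ (fold v)  = bv-⌜⌝ᵥ v

fv-⌜⌝ᵥ : ∀ v → fv ⌜ v ⌝ᵥ ≡ valVars v
fv-⌜⌝ᵥ unit      = refl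
fv-⌜⌝ᵥ (var x)   = refl
fv-⌜⌝ᵥ (inl v)   = fv-⌜⌝ᵥ v
fv-⌜⌝ᵥ (inr v)   = fv-⌜⌝ᵥ v
fv-⌜⌝ᵥ ⟨ v , w ⟩ = cong₂ _++_ (fv-⌜⌝ᵥ v) (fv-⌜⌝ᵥ w)
fv-⌜⌝ᵥ (fold v)  = fv-⌜⌝ᵥ v

bv-⌜⌝ₑ : ∀ e → bv ⌜ e ⌝ₑ ≡ bvE e
bv-⌜⌝ₑ (val v)        = bv-⌜⌝ᵥ v
bv-⌜⌝ₑ (elet p ω q e) =
  cong (patVars p ++_) (cong₂ _++_ (trans (cong (bvI ω ++_) (bv-⌜⌝ᵥ (patVal q))) (++-identityʳ (bvI ω)))
                                   (bv-⌜⌝ₑ e))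

valVars-patVal : ∀ p → valVars (patVal p) ≡ patVars p
valVars-patVal (pvar x)   = refl
valVars-patVal ⟨ p , q ⟩ₚ = cong₂ _++_ (valVars-patVal p) (valVars-patVal q)

⊢-tupPat : ∀ {n} (bs : Vec (Var × Type) (suc n)) → Unique (names (toList bs)) →
           toList bs ⨾ Ψ ⊢ₑ ⌜ patVal (tupPat (Vec.map proj₁ bs)) ⌝ᵥ ∶ tupTy (Vec.map proj₂ bs)
⊢-tupPat (b Vec.∷ Vec.[])       _ = ty-var
⊢-tupPat (b Vec.∷ (c Vec.∷ bs)) u =
  ty-pair ty-var (⊢-tupPat (c Vec.∷ bs) (Unique-++⁻ʳ (proj₁ b ∷ []) u)) u ↭-refl

lookupσ-∉dom : ∀ σ → x ∉ dom σ → lookupσ σ x ≡ nothing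
lookupσ-∉dom [] _ = refl
lookupσ-∉dom {x} ((y , _) ∷ σ) x∉ with x ≡ᵇ y | ≡ᵇ-reflects x y
... | true  | ofʸ x≡y = ⊥-elim (x∉ (here x≡y))
... | false | _       = lookupσ-∉dom σ (x∉ ∘ there)

lookupσ-++-∈ˡ : ∀ σ₁ σ₂ → x ∈ dom σ₁ → lookupσ (σ₁ ++ σ₂) x ≡ lookupσ σ₁ x
lookupσ-++-∈ˡ {x} ((y , _) ∷ σ₁) σ₂ x∈ with x ≡ᵇ y | ≡ᵇ-reflects x y
... | true  | _       = refl
... | false | ofⁿ x≢y = lookupσ-++-∈ˡ σ₁ σ₂ (tail x≢y x∈)

lookupσ-++-∉ˡ : ∀ σ₁ σ₂ → x ∉ dom σ₁ → lookupσ (σ₁ ++ σ₂) x ≡ lookupσ σ₂ x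
lookupσ-++-∉ˡ [] σ₂ _ = refl
lookupσ-++-∉ˡ {x} ((y , _) ∷ σ₁) σ₂ x∉ with x ≡ᵇ y | ≡ᵇ-reflects x y
... | true  | ofʸ x≡y = ⊥-elim (x∉ (here x≡y))
... | false | _       = lookupσ-++-∉ˡ σ₁ σ₂ (x∉ ∘ there)

lookupσ-removeσ-∈ : ∀ σ xs → x ∈ xs → lookupσ (removeσ σ xs) x ≡ nothing
lookupσ-removeσ-∈ [] xs _ = refl
lookupσ-removeσ-∈ {x} ((y , _) ∷ σ) xs x∈ with memb y xs | memb-reflects y xs
... | true  | _       = lookupσ-removeσ-∈ σ xs x∈
... | false | ofⁿ y∉ with x ≡ᵇ y | ≡ᵇ-reflects x y
...   | true  | ofʸ refl = ⊥-elim (y∉ x∈)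
...   | false | _        = lookupσ-removeσ-∈ σ xs x∈

lookupσ-removeσ-∉ : ∀ σ xs → x ∉ xs → lookupσ (removeσ σ xs) x ≡ lookupσ σ x
lookupσ-removeσ-∉ [] xs _ = refl
lookupσ-removeσ-∉ {x} ((y , _) ∷ σ) xs x∉ with memb y xs | memb-reflects y xs
... | false | _ with x ≡ᵇ y
...   | true  = refl
...   | false = lookupσ-removeσ-∉ σ xs x∉
lookupσ-removeσ-∉ {x} ((y , _) ∷ σ) xs x∉ | true | ofʸ y∈ with x ≡ᵇ y | ≡ᵇ-reflects x y
...   | true  | ofʸ refl = ⊥-elim (x∉ y∈)
...   | false | _        = lookupσ-removeσ-∉ σ xs x∉

data BindingTyped (Ψ : IsoCtx) (σ : Subst) (x : Var) (C : Type) : Ctx → Set₁ where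
  substituted : ∀ {w E} → lookupσ σ x ≡ just w → E ⨾ Ψ ⊢ₑ ⌜ w ⌝ᵥ ∶ C → BindingTyped Ψ σ x C E
  unchanged   : lookupσ σ x ≡ nothing → BindingTyped Ψ σ x C ((x , C) ∷ [])

data SubstTyped (Ψ : IsoCtx) (σ : Subst) : Ctx → Ctx → Set₁ where
  []  : SubstTyped Ψ σ [] []
  _∷_ : ∀ {x C E Γ D} → BindingTyped Ψ σ x C E → SubstTyped Ψ σ Γ D →
        SubstTyped Ψ σ ((x , C) ∷ Γ) (E ++ D)

module _ {Ψ : IsoCtx} {σ : Subst} where

  SubstTyped-++⁺ : ∀ {Γ₁ Γ₂ D₁ D₂} → SubstTyped Ψ σ Γ₁ D₁ → SubstTyped Ψ σ Γ₂ D₂ →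
                   SubstTyped Ψ σ (Γ₁ ++ Γ₂) (D₁ ++ D₂)
  SubstTyped-++⁺ []                    s₂ = s₂
  SubstTyped-++⁺ (_∷_ {E = E} {D = D₁} b s₁) s₂ =
    subst (SubstTyped Ψ σ _) (sym (++-assoc E D₁ _)) (b ∷ SubstTyped-++⁺ s₁ s₂)

  SubstTyped-++⁻ : ∀ Γ₁ {Γ₂ D} → SubstTyped Ψ σ (Γ₁ ++ Γ₂) D →
                   ∃[ D₁ ] ∃[ D₂ ] (SubstTyped Ψ σ Γ₁ D₁ × SubstTyped Ψ σ Γ₂ D₂ × D ≡ D₁ ++ D₂)
  SubstTyped-++⁻ []       s = [] , _ , [] , s , refl
  SubstTyped-++⁻ (_ ∷ Γ₁) (_∷_ {E = E} b s) with SubstTyped-++⁻ Γ₁ s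
  ... | D₁ , D₂ , s₁ , s₂ , refl = E ++ D₁ , D₂ , b ∷ s₁ , s₂ , sym (++-assoc E D₁ D₂)

  SubstTyped-resp-↭ : ∀ {Γ Γ' D} → SubstTyped Ψ σ Γ D → Γ ↭ Γ' →
                      ∃[ D' ] (SubstTyped Ψ σ Γ' D' × D ↭ D')
  SubstTyped-resp-↭ s ↭.refl = _ , s , ↭-refl
  SubstTyped-resp-↭ (_∷_ {E = E} b s) (↭.prep _ p) with SubstTyped-resp-↭ s p
  ... | D' , s' , q = E ++ D' , b ∷ s' , ↭.++⁺ˡ E q
  SubstTyped-resp-↭ (_∷_ {E = Ea} a (_∷_ {E = Eb} b s)) (↭.swap _ _ p) with SubstTyped-resp-↭ s p
  ... | D' , s' , q = Eb ++ Ea ++ D' , b ∷ a ∷ s' , ↭-trans (↭.++⁺ˡ Ea (↭.++⁺ˡ Eb q)) (↭.shifts Ea Eb)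
  SubstTyped-resp-↭ s (↭.trans p₁ p₂) with SubstTyped-resp-↭ s p₁
  ... | D₁ , s₁ , q₁ with SubstTyped-resp-↭ s₁ p₂
  ...   | D₂ , s₂ , q₂ = D₂ , s₂ , ↭-trans q₁ q₂

  SubstTyped-split : ∀ {Γ D} → SubstTyped Ψ σ Γ D → Γ ↭ Δ₁ ++ Δ₂ →
                     ∃[ D₁ ] ∃[ D₂ ] (SubstTyped Ψ σ Δ₁ D₁ × SubstTyped Ψ σ Δ₂ D₂ × D ↭ D₁ ++ D₂)
  SubstTyped-split {Δ₁ = Δ₁} s p with SubstTyped-resp-↭ s p
  ... | _ , s' , q with SubstTyped-++⁻ Δ₁ s'
  ...   | D₁ , D₂ , s₁ , s₂ , refl = D₁ , D₂ , s₁ , s₂ , q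

  SubstTyped-unchanged : ∀ Γ → (∀ {x} → x ∈ names Γ → lookupσ σ x ≡ nothing) → SubstTyped Ψ σ Γ Γ
  SubstTyped-unchanged []      _   = []
  SubstTyped-unchanged (_ ∷ Γ) out = unchanged (out (here refl)) ∷ SubstTyped-unchanged Γ (out ∘ there)

SubstTyped-cong : ∀ {σ σ'} → (∀ {x} → x ∈ names Γ → lookupσ σ x ≡ lookupσ σ' x) →
                  SubstTyped Ψ σ Γ D → SubstTyped Ψ σ' Γ D
SubstTyped-cong agree [] = []
SubstTyped-cong agree (substituted l d ∷ s) =
  substituted (trans (sym (agree (here refl))) l) d ∷ SubstTyped-cong (agree ∘ there) s
SubstTyped-cong agree (unchanged l ∷ s) =
  unchanged (trans (sym (agree (here refl))) l) ∷ SubstTyped-cong (agree ∘ there) s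

Disjoint-⊆ : ∀ {xs' ys'} → (∀ {x} → x ∈ xs' → x ∈ xs) → (∀ {x} → x ∈ ys' → x ∈ ys) →
             Disjoint xs ys → Disjoint xs' ys'
Disjoint-⊆ f g dis (x∈ , y∈) = dis (f x∈ , g y∈)

SubstTyped-binder : ∀ {σ} Θ → SubstTyped Ψ σ Γ D → Disjoint (names Γ) (names Θ) →
                    SubstTyped Ψ (removeσ σ (names Θ)) (Γ ++ Θ) (D ++ Θ)
SubstTyped-binder {σ = σ} Θ s dis = SubstTyped-++⁺
  (SubstTyped-cong (λ x∈Γ → sym (lookupσ-removeσ-∉ σ (names Θ) (λ x∈Θ → dis (x∈Γ , x∈Θ)))) s)
  (SubstTyped-unchanged Θ (lookupσ-removeσ-∈ σ (names Θ)))

-- The freshness hypotheses keep the let-bound variables of t apart from those introduced by σ.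
⊢-subst : ∀ {σ} → Γ ⨾ Ψ ⊢ₑ t ∶ B → SubstTyped Ψ σ Γ D →
          Unique (names D) → Unique (bv t) → Disjoint (names D) (bv t) →
          D ⨾ Ψ ⊢ₑ applyS σ t ∶ B
⊢-subst ty-unit [] _ _ _ = ty-unit
⊢-subst ty-var (substituted {E = E} l d ∷ []) _ _ _ rewrite l = ⊢-resp-↭ (↭-sym (↭.++-identityʳ E)) d
⊢-subst ty-var (unchanged l ∷ []) _ _ _ rewrite l = ty-var
⊢-subst (ty-inl d)  s uD ub dis = ty-inl (⊢-subst d s uD ub dis)
⊢-subst (ty-inr d)  s uD ub dis = ty-inr (⊢-subst d s uD ub dis)
⊢-subst (ty-fold d) s uD ub dis = ty-fold (⊢-subst d s uD ub dis)
⊢-subst (ty-appvar i d) s uD ub dis = ty-appvar i (⊢-subst d s uD ub dis)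
⊢-subst (ty-app {ω = ω} i d) s uD ub dis =
  ty-app i (⊢-subst d s uD (Unique-++⁻ʳ (bvI ω) ub) (Disjoint-⊆ (λ x∈ → x∈) (∈-++⁺ʳ (bvI ω)) dis))
⊢-subst (ty-pair {t₁ = t₁} d₁ d₂ _ q) s uD ub dis with SubstTyped-split s q
... | D₁ , D₂ , s₁ , s₂ , r =
  ty-pair (⊢-subst d₁ s₁ (Unique-names-++⁻ˡ D₁ D₂ u₁₂) (Unique-++⁻ˡ (bv t₁) ub)
                   (Disjoint-⊆ (∈-names-resp-↭ (↭-sym r) ∘ ∈-names-++⁺ˡ D₁ D₂) ∈-++⁺ˡ dis))
          (⊢-subst d₂ s₂ (Unique-names-++⁻ʳ D₁ D₂ u₁₂) (Unique-++⁻ʳ (bv t₁) ub)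
                   (Disjoint-⊆ (∈-names-resp-↭ (↭-sym r) ∘ ∈-names-++⁺ʳ D₁ D₂) (∈-++⁺ʳ (bv t₁)) dis))
          u₁₂ r
  where
  u₁₂ = Unique-names-resp-↭ r uD
⊢-subst {Ψ = Ψ} {σ = σ} (ty-let {Δ₂ = Δ₂} {t₁ = t₁} {t₂} {B} bs d₁ d₂ _ u₂ q) s uD ub dis
  with SubstTyped-split s q
... | D₁ , D₂ , s₁ , s₂ , r =
  ty-let bs (⊢-subst d₁ s₁ (Unique-names-++⁻ˡ D₁ D₂ u₁₂) (Unique-++⁻ˡ (bv t₁) ub₁₂)
                     (Disjoint-⊆ (∈-names-resp-↭ (↭-sym r) ∘ ∈-names-++⁺ˡ D₁ D₂) (∈-++⁺ʳ pv ∘ ∈-++⁺ˡ) dis))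
            (subst (λ ys → D₂ ++ Θ ⨾ Ψ ⊢ₑ applyS (removeσ σ ys) t₂ ∶ B) (sym (patVars-tupPat bs)) body)
            u₁₂ uD₂Θ r
  where
  Θ   = toList bs
  pv  = patVars (tupPat (Vec.map proj₁ bs))
  ub₁₂ = Unique-++⁻ʳ pv ub
  u₁₂ = Unique-names-resp-↭ r uD
  Θ⊆pv : ∀ {x} → x ∈ names Θ → x ∈ pv
  Θ⊆pv = subst (_ ∈_) (sym (patVars-tupPat bs))
  D₂⊆D : ∀ {x} → x ∈ names D₂ → x ∈ names _
  D₂⊆D = ∈-names-resp-↭ (↭-sym r) ∘ ∈-names-++⁺ʳ D₁ D₂
  uD₂Θ : Unique (names (D₂ ++ Θ))
  uD₂Θ = Unique-names-++⁺ D₂ Θ (Unique-names-++⁻ʳ D₁ D₂ u₁₂) (Unique-names-++⁻ʳ Δ₂ Θ u₂)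
                          (Disjoint-⊆ D₂⊆D (∈-++⁺ˡ ∘ Θ⊆pv) dis)
  D₂Θ#t₂ : Disjoint (names (D₂ ++ Θ)) (bv t₂)
  D₂Θ#t₂ (x∈ , x∈t₂) with ∈-names-++⁻ D₂ Θ x∈
  ... | inj₁ x∈D₂ = dis (D₂⊆D x∈D₂ , ∈-++⁺ʳ pv (∈-++⁺ʳ (bv t₁) x∈t₂))
  ... | inj₂ x∈Θ  = Unique-++⇒Disjoint pv ub (Θ⊆pv x∈Θ , ∈-++⁺ʳ (bv t₁) x∈t₂)
  body : D₂ ++ Θ ⨾ Ψ ⊢ₑ applyS (removeσ σ (names Θ)) t₂ ∶ B
  body = ⊢-subst d₂ (SubstTyped-binder Θ s₂ (Unique-names-++⇒Disjoint Δ₂ Θ u₂)) uD₂Θ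
                 (Unique-++⁻ʳ (bv t₁) ub₁₂) D₂Θ#t₂

dom-match : ∀ {σ u v} → Match σ u v → dom σ ≡ valVars u
dom-match m-var        = refl
dom-match m-unit       = refl
dom-match (m-inl m)    = dom-match m
dom-match (m-inr m)    = dom-match m
dom-match (m-fold m)   = dom-match m
dom-match (m-pair {σ₁ = σ₁} {σ₂} m₁ m₂ _) =
  trans (map-++ proj₁ σ₁ σ₂) (cong₂ _++_ (dom-match m₁) (dom-match m₂))

match-names⊆dom : ∀ {σ u v} → Match σ u v → Δ ⨾ Ψ ⊢ₑ ⌜ u ⌝ᵥ ∶ A → x ∈ names Δ → x ∈ dom σ
match-names⊆dom {u = u} m d x∈ = subst (_ ∈_) (trans (fv-⌜⌝ᵥ u) (sym (dom-match m))) (⊢-names⊆fv d x∈)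

lookupσ-singleton : ∀ x w → lookupσ ((x , w) ∷ []) x ≡ just w
lookupσ-singleton x w with x ≡ᵇ x | ≡ᵇ-reflects x x
... | true  | _       = refl
... | false | ofⁿ x≢x = ⊥-elim (x≢x refl)

match-typed : ∀ {σ u v Θ Ψ₁} → Match σ u v → Θ ⨾ Ψ₁ ⊢ₑ ⌜ u ⌝ᵥ ∶ A → Δ ⨾ Ψ ⊢ₑ ⌜ v ⌝ᵥ ∶ A →
              ∃[ D ] (SubstTyped Ψ σ Θ D × D ↭ Δ)
match-typed (m-var {x} {w}) ty-var dv = _ , substituted (lookupσ-singleton x w) dv ∷ [] , ↭.++-identityʳ _
match-typed m-unit     ty-unit    ty-unit     = [] , [] , ↭-refl
match-typed (m-inl m)  (ty-inl d) (ty-inl d') = match-typed m d d'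
match-typed (m-inr m)  (ty-inr d) (ty-inr d') = match-typed m d d'
match-typed (m-fold m) (ty-fold d) (ty-fold d') = match-typed m d d'
match-typed (m-pair {σ₁ = σ₁} {σ₂} m₁ m₂ dom#) (ty-pair {Δ₁ = Θ₁} {Θ₂} dθ₁ dθ₂ _ qθ) (ty-pair dv₁ dv₂ _ qv)
  with match-typed m₁ dθ₁ dv₁ | match-typed m₂ dθ₂ dv₂
... | D₁ , s₁ , r₁ | D₂ , s₂ , r₂
  with SubstTyped-resp-↭ (SubstTyped-++⁺ (SubstTyped-cong agree₁ s₁) (SubstTyped-cong agree₂ s₂)) (↭-sym qθ)
  where
  agree₁ : ∀ {x} → x ∈ names Θ₁ → lookupσ σ₁ x ≡ lookupσ (σ₁ ++ σ₂) x
  agree₁ = λ x∈ → sym (lookupσ-++-∈ˡ σ₁ σ₂ (match-names⊆dom m₁ dθ₁ x∈))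
  agree₂ : ∀ {x} → x ∈ names Θ₂ → lookupσ σ₂ x ≡ lookupσ (σ₁ ++ σ₂) x
  agree₂ = λ x∈ → sym (lookupσ-++-∉ˡ σ₁ σ₂ (λ x∈σ₁ → dom# (x∈σ₁ , match-names⊆dom m₂ dθ₂ x∈)))
... | D , s , r = D , s , ↭-trans (↭-sym r) (↭-trans (↭.++⁺ r₁ r₂) (↭-sym qv))

⊢⇒Disjoint-names-bv : WellNamed t → Δ ⨾ Ψ ⊢ₑ t ∶ A → Disjoint (names Δ) (bv t)
⊢⇒Disjoint-names-bv (_ , bv#fv) d (x∈Δ , x∈bv) = bv#fv (x∈bv , ⊢-names⊆fv d x∈Δ)

⊢-let-β : ∀ {σ p v} → WellNamed (letₜ p ⌜ v ⌝ᵥ t) → Δ ⨾ Ψ ⊢ₑ letₜ p ⌜ v ⌝ᵥ t ∶ A →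
          Match σ (patVal p) v → Δ ⨾ Ψ ⊢ₑ applyS σ t ∶ A
⊢-let-β {Δ = Δ} {σ = σ} {v = v} wn@(ub , _) d@(ty-let {Δ₁ = Δ₁} {Δ₂} bs d₁ d₂ _ u₂ q) m
  with match-typed m (⊢-tupPat {Ψ = nothing} bs (Unique-names-++⁻ʳ Δ₂ (toList bs) u₂)) d₁
... | D , s , r =
  ⊢-resp-↭ perm (⊢-subst d₂ (SubstTyped-++⁺ (SubstTyped-unchanged Δ₂ Δ₂∉domσ) s)
                         (Unique-names-resp-↭ (↭-sym perm) (⊢⇒Unique-names d))
                         (Unique-++⁻ʳ (bv ⌜ v ⌝ᵥ) (Unique-++⁻ʳ pv ub))
                         (Disjoint-⊆ (∈-names-resp-↭ perm) (∈-++⁺ʳ pv ∘ ∈-++⁺ʳ (bv ⌜ v ⌝ᵥ))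
                                     (⊢⇒Disjoint-names-bv wn d)))
  where
  Θ  = toList bs
  pv = patVars (tupPat (Vec.map proj₁ bs))
  perm : Δ₂ ++ D ↭ Δ
  perm = ↭-trans (↭.++⁺ˡ Δ₂ r) (↭-trans (↭.++-comm Δ₂ Δ₁) (↭-sym q))
  domσ≡Θ : dom σ ≡ names Θ
  domσ≡Θ = trans (dom-match m) (trans (valVars-patVal (tupPat (Vec.map proj₁ bs))) (patVars-tupPat bs))
  Δ₂∉domσ : ∀ {x} → x ∈ names Δ₂ → lookupσ σ x ≡ nothing
  Δ₂∉domσ x∈ = lookupσ-∉dom σ (λ x∈σ → Unique-names-++⇒Disjoint Δ₂ Θ u₂ (x∈ , subst (_ ∈_) domσ≡Θ x∈σ))

bvE⊆bvCls : ∀ {v e} cls → (v , e) ∈ cls → x ∈ bvE e → x ∈ bvCls cls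
bvE⊆bvCls ((v , e) ∷ _)   (here refl) x∈ = ∈-++⁺ʳ (valVars v) (∈-++⁺ˡ x∈)
bvE⊆bvCls ((v , e) ∷ cls) (there c∈)  x∈ = ∈-++⁺ʳ (valVars v) (∈-++⁺ʳ (bvE e) (bvE⊆bvCls cls c∈ x∈))

Unique-bvCls⇒Unique-bvE : ∀ {v e} cls → (v , e) ∈ cls → Unique (bvCls cls) → Unique (bvE e)
Unique-bvCls⇒Unique-bvE ((v , e) ∷ _)   (here refl) u = Unique-++⁻ˡ (bvE e) (Unique-++⁻ʳ (valVars v) u)
Unique-bvCls⇒Unique-bvE ((v , e) ∷ cls) (there c∈)  u =
  Unique-bvCls⇒Unique-bvE cls c∈ (Unique-++⁻ʳ (bvE e) (Unique-++⁻ʳ (valVars v) u))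

⊢-iso-β : ∀ {σ cls v e v'} → WellNamed (appₜ (clauses cls) ⌜ v' ⌝ᵥ) →
          Δ ⨾ Ψ ⊢ₑ appₜ (clauses cls) ⌜ v' ⌝ᵥ ∶ A → (v , e) ∈ cls → Match σ v v' →
          Δ ⨾ Ψ ⊢ₑ applyS σ ⌜ e ⌝ₑ ∶ A
⊢-iso-β {cls = cls} {e = e} wn@(ub , _) d@(ty-app (ty-clauses _ typed _ _) dv) c∈ m
  with All.lookup typed c∈
... | _ , dθ , de with match-typed m dθ dv
...   | D , s , r =
  ⊢-resp-↭ r (⊢-subst (⊢-weaken-isoCtx de) s (Unique-names-resp-↭ (↭-sym r) (⊢⇒Unique-names d))
                      (subst Unique (sym (bv-⌜⌝ₑ e)) (Unique-bvCls⇒Unique-bvE cls c∈ (Unique-++⁻ˡ (bvCls cls) ub)))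
                      (Disjoint-⊆ (∈-names-resp-↭ r) (∈-++⁺ˡ ∘ bvE⊆bvCls cls c∈ ∘ subst (_ ∈_) (bv-⌜⌝ₑ e))
                                  (⊢⇒Disjoint-names-bv wn d)))

module IsoSubstitution (g : IVar) (ω₀ : Iso) where

  isubT : Term → Term
  isubT unitₜ        = unitₜ
  isubT (varₜ x)     = varₜ x
  isubT (inlₜ t)     = inlₜ (isubT t)
  isubT (inrₜ t)     = inrₜ (isubT t)
  isubT (pairₜ t u)  = pairₜ (isubT t) (isubT u)
  isubT (foldₜ t)    = foldₜ (isubT t)
  isubT (appₜ ω t)   = appₜ (isubI g ω₀ ω) (isubT t)
  isubT (letₜ p t u) = letₜ p (isubT t) (isubT u)

  isubT-⌜⌝ᵥ : ∀ v → isubT ⌜ v ⌝ᵥ ≡ ⌜ v ⌝ᵥ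
  isubT-⌜⌝ᵥ unit      = refl
  isubT-⌜⌝ᵥ (var x)   = refl
  isubT-⌜⌝ᵥ (inl v)   = cong inlₜ (isubT-⌜⌝ᵥ v)
  isubT-⌜⌝ᵥ (inr v)   = cong inrₜ (isubT-⌜⌝ᵥ v)
  isubT-⌜⌝ᵥ ⟨ v , w ⟩ = cong₂ pairₜ (isubT-⌜⌝ᵥ v) (isubT-⌜⌝ᵥ w)
  isubT-⌜⌝ᵥ (fold v)  = cong foldₜ (isubT-⌜⌝ᵥ v)

  isubT-⌜⌝ₑ : ∀ e → isubT ⌜ e ⌝ₑ ≡ ⌜ isubE g ω₀ e ⌝ₑ
  isubT-⌜⌝ₑ (val v)        = isubT-⌜⌝ᵥ v
  isubT-⌜⌝ₑ (elet p ω q e) =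
    cong₂ (letₜ p) (cong (appₜ (isubI g ω₀ ω)) (isubT-⌜⌝ᵥ (patVal q))) (isubT-⌜⌝ₑ e)

  map-proj₁-isubCls : ∀ cls → map proj₁ (isubCls g ω₀ cls) ≡ map proj₁ cls
  map-proj₁-isubCls []             = refl
  map-proj₁-isubCls ((v , _) ∷ cls) = cong (v ∷_) (map-proj₁-isubCls cls)

  valOf-isubE : ∀ e → valOf (isubE g ω₀ e) ≡ valOf e
  valOf-isubE (val v)        = refl
  valOf-isubE (elet _ _ _ e) = valOf-isubE e

  map-valOf-isubCls : ∀ cls → map (valOf ∘ proj₂) (isubCls g ω₀ cls) ≡ map (valOf ∘ proj₂) cls
  map-valOf-isubCls []             = refl
  map-valOf-isubCls ((_ , e) ∷ cls) = cong₂ _∷_ (valOf-isubE e) (map-valOf-isubCls cls)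

  module _ (ω₀≢ivar : ∀ {h} → ω₀ ≢ ivar h) where

    isubI≡ivar⁻ : ∀ ω {h} → isubI g ω₀ ω ≡ ivar h → ω ≡ ivar h
    isubI≡ivar⁻ (clauses _) ()
    isubI≡ivar⁻ (fix k ω) eq with g ≡ᵇ k
    isubI≡ivar⁻ (fix k ω) () | true
    isubI≡ivar⁻ (fix k ω) () | false
    isubI≡ivar⁻ (ivar k) eq with g ≡ᵇ k
    ... | true  = ⊥-elim (ω₀≢ivar eq)
    ... | false = eq

    Calls-isubE⁻ : ∀ {h p} e → Calls h p (isubE g ω₀ e) → Calls h p e
    Calls-isubE⁻ (elet p₁ ω q e) c with isubI g ω₀ ω in eq
    Calls-isubE⁻ (elet p₁ ω q e) here      | _ =
      subst (λ ω → Calls _ q (elet p₁ ω q e)) (sym (isubI≡ivar⁻ ω eq)) here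
    Calls-isubE⁻ (elet p₁ ω q e) (there c) | _ = there (Calls-isubE⁻ e c)

    StructRec-isubI : ∀ {h ω β} → StructRec h ω β → StructRec h (isubI g ω₀ ω) β
    StructRec-isubI (sr cls As j B eq srs) = sr (isubCls g ω₀ cls) As j B eq (go cls srs)
      where
      go : ∀ {h k As j B} cls → All (λ c → SRClause h {k} As j B (proj₁ c) (proj₂ c)) cls →
           All (λ c → SRClause h As j B (proj₁ c) (proj₂ c)) (isubCls g ω₀ cls)
      go [] [] = []
      go ((_ , e) ∷ cls) (src-closed vs eq cl noCall ∷ srs) =
        src-closed vs eq cl (λ p → noCall p ∘ Calls-isubE⁻ e) ∷ go cls srs
      go ((_ , e) ∷ cls) (src-open vs eq ncl calls ∷ srs) =
        src-open vs eq ncl (λ p → calls p ∘ Calls-isubE⁻ e) ∷ go cls srs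

    module _ {α : IsoTy} (⊢ω₀ : nothing ⊢ω ω₀ ∶ α) where

      data Discharges : IsoCtx → IsoCtx → Set where
        discharge : Discharges (just (g , α)) nothing
        untouched : ∀ {Ψ} → (∀ {β} → Ψ ≢ just (g , β)) → Discharges Ψ Ψ

      mutual
        ⊢-isubT : ∀ {Ψ Ψ'} → Discharges Ψ Ψ' → Δ ⨾ Ψ ⊢ₑ t ∶ B → Δ ⨾ Ψ' ⊢ₑ isubT t ∶ B
        ⊢-isubT r ty-unit                   = ty-unit
        ⊢-isubT r ty-var                    = ty-var
        ⊢-isubT r (ty-inl d)                = ty-inl (⊢-isubT r d)
        ⊢-isubT r (ty-inr d)                = ty-inr (⊢-isubT r d)
        ⊢-isubT r (ty-pair d₁ d₂ u q)       = ty-pair (⊢-isubT r d₁) (⊢-isubT r d₂) u q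
        ⊢-isubT r (ty-fold d)               = ty-fold (⊢-isubT r d)
        ⊢-isubT r (ty-let bs d₁ d₂ u₁ u₂ q) = ty-let bs (⊢-isubT r d₁) (⊢-isubT r d₂) u₁ u₂ q
        ⊢-isubT r (ty-app i d)              = ty-app (⊢ω-isubI (untouched λ ()) i) (⊢-isubT r d)
        ⊢-isubT discharge (ty-appvar ty-ivar d) with g ≡ᵇ g | ≡ᵇ-reflects g g
        ... | true  | _       = ty-app ⊢ω₀ (⊢-isubT discharge d)
        ... | false | ofⁿ g≢g = ⊥-elim (g≢g refl)
        ⊢-isubT (untouched g∉Ψ) (ty-appvar (ty-ivar {f = h}) d) with g ≡ᵇ h | ≡ᵇ-reflects g h
        ... | true  | ofʸ refl = ⊥-elim (g∉Ψ refl)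
        ... | false | _        = ty-appvar ty-ivar (⊢-isubT (untouched g∉Ψ) d)

        ⊢ω-isubI : ∀ {Ψ Ψ' ω β} → Discharges Ψ Ψ' → Ψ ⊢ω ω ∶ β → Ψ' ⊢ω isubI g ω₀ ω ∶ β
        ⊢ω-isubI {β = A ⟷ B} r (ty-clauses cls typed od₁ od₂) =
          ty-clauses (isubCls g ω₀ cls) (⊢-isubCls r cls typed)
            (subst (λ vs → OD A (_∈ vs)) (sym (map-proj₁-isubCls cls)) od₁)
            (subst (λ ws → OD B (_∈ ws)) (sym (map-valOf-isubCls cls)) od₂)
        ⊢ω-isubI discharge ty-ivar with g ≡ᵇ g | ≡ᵇ-reflects g g
        ... | true  | _       = ⊢ω₀
        ... | false | ofⁿ g≢g = ⊥-elim (g≢g refl)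
        ⊢ω-isubI (untouched g∉Ψ) (ty-ivar {f = h}) with g ≡ᵇ h | ≡ᵇ-reflects g h
        ... | true  | ofʸ refl = ⊥-elim (g∉Ψ refl)
        ... | false | _        = ty-ivar
        ⊢ω-isubI r (ty-fix {f = h} ⊢ω s) with g ≡ᵇ h | ≡ᵇ-reflects g h
        ... | true  | _       = ty-fix ⊢ω s
        ... | false | ofⁿ g≢h = ty-fix (⊢ω-isubI (untouched λ { refl → g≢h refl }) ⊢ω) (StructRec-isubI s)

        ⊢-isubCls : ∀ {Ψ Ψ' A B} → Discharges Ψ Ψ' → ∀ cls →
                    All (λ c → ∃[ Δ ] ((Δ ⨾ nothing ⊢ₑ ⌜ proj₁ c ⌝ᵥ ∶ A) × (Δ ⨾ Ψ ⊢ₑ ⌜ proj₂ c ⌝ₑ ∶ B))) cls →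
                    All (λ c → ∃[ Δ ] ((Δ ⨾ nothing ⊢ₑ ⌜ proj₁ c ⌝ᵥ ∶ A) × (Δ ⨾ Ψ' ⊢ₑ ⌜ proj₂ c ⌝ₑ ∶ B)))
                        (isubCls g ω₀ cls)
        ⊢-isubCls r [] [] = []
        ⊢-isubCls {Ψ' = Ψ'} {B = B} r ((_ , e) ∷ cls) ((Δ , dv , de) ∷ typed) =
          (Δ , dv , subst (λ u → Δ ⨾ Ψ' ⊢ₑ u ∶ B) (isubT-⌜⌝ₑ e) (⊢-isubT r de)) ∷ ⊢-isubCls r cls typed

⊢ω-unfold : ∀ {f ω α} → nothing ⊢ω fix f ω ∶ α → nothing ⊢ω isubI f (fix f ω) ω ∶ α
⊢ω-unfold {f} {ω} ⊢fix@(ty-fix ⊢ω _) = ⊢ω-isubI (λ ()) ⊢fix discharge ⊢ω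
  where open IsoSubstitution f (fix f ω)

WellNamed-app : ∀ ω t → WellNamed (appₜ ω t) → WellNamed t
WellNamed-app ω t (ub , dis) = Unique-++⁻ʳ (bvI ω) ub , Disjoint-⊆ (∈-++⁺ʳ (bvI ω)) (∈-++⁺ʳ (fvI ω)) dis

WellNamed-pairˡ : ∀ t u → WellNamed (pairₜ t u) → WellNamed t
WellNamed-pairˡ t u (ub , dis) = Unique-++⁻ˡ (bv t) ub , Disjoint-⊆ ∈-++⁺ˡ ∈-++⁺ˡ dis

WellNamed-pairʳ : ∀ t u → WellNamed (pairₜ t u) → WellNamed u
WellNamed-pairʳ t u (ub , dis) = Unique-++⁻ʳ (bv t) ub , Disjoint-⊆ (∈-++⁺ʳ (bv t)) (∈-++⁺ʳ (fv t)) dis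

WellNamed-let : ∀ p t u → WellNamed (letₜ p t u) → WellNamed t
WellNamed-let p t u (ub , dis) =
  Unique-++⁻ˡ (bv t) (Unique-++⁻ʳ (patVars p) ub) , Disjoint-⊆ (∈-++⁺ʳ (patVars p) ∘ ∈-++⁺ˡ) ∈-++⁺ˡ dis

mainTheorem5 : ∀ {Δ Ψ t t' A} → WellNamed t →
    Δ ⨾ Ψ ⊢ₑ t ∶ A → t ⟶ t' → Δ ⨾ Ψ ⊢ₑ t' ∶ A
mainTheorem5 wn (ty-inl d)      (c-inl r)  = ty-inl (mainTheorem5 wn d r)
mainTheorem5 wn (ty-inr d)      (c-inr r)  = ty-inr (mainTheorem5 wn d r)
mainTheorem5 wn (ty-fold d)     (c-fold r) = ty-fold (mainTheorem5 wn d r)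
mainTheorem5 {t = appₜ ω t} wn (ty-appvar i d) (c-app r) =
  ty-appvar i (mainTheorem5 (WellNamed-app ω t wn) d r)
mainTheorem5 {t = appₜ ω t} wn (ty-app i d) (c-app r) =
  ty-app i (mainTheorem5 (WellNamed-app ω t wn) d r)
mainTheorem5 {t = pairₜ t u} wn (ty-pair d₁ d₂ uq q) (c-pairₗ r) =
  ty-pair (mainTheorem5 (WellNamed-pairˡ t u wn) d₁ r) d₂ uq q
mainTheorem5 {t = pairₜ u t} wn (ty-pair d₁ d₂ uq q) (c-pairᵣ r) =
  ty-pair d₁ (mainTheorem5 (WellNamed-pairʳ u t wn) d₂ r) uq q
mainTheorem5 {t = letₜ p t u} wn (ty-let bs d₁ d₂ u₁ u₂ q) (c-let r) =
  ty-let bs (mainTheorem5 (WellNamed-let p t u wn) d₁ r) d₂ u₁ u₂ q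
mainTheorem5 wn (ty-app i d) (c-iso r-fix) = ty-app (⊢ω-unfold i) d
mainTheorem5 wn d (r-let m)      = ⊢-let-β wn d m
mainTheorem5 wn d (r-iso c∈ m)   = ⊢-iso-β wn d c∈ m
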